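{- Let $F$ be a figure with an equilibrium function $eq$ and associated set $\mathcal{H}_F$ of height functions. Let $v,v'\in V_F$ be two vertices lying on a common critical cycle of $G_F$. Then for all $h,h'\in\mathcal{H}_F$ one has $h(v)-h'(v)=h(v')-h'(v')$.
   Context: Square grid $\Lambda$ with vertices $\mathbb{Z}^2$, unit edges, unit square cells coloured black/white as a checkerboard. A figure $F$ is a finite 4-connected union of cells. $H_\infty$ is the unbounded 8-connected component of $\mathbb{R}^2\setminus F$. Every vertex all of whose incident edges lie on the boundary of $F$ (two cells of $F$ meeting only at that corner) is replaced by two copies, each adjacent to the two neighbours lying on one of these cells. $G_F=(V_F,E_F)$: vertices are corners of cells of $F$ (after duplication), arcs are both orientations of each side of each cell of $F$; $E_b(F)$: arcs whose edge lies on the boundary of $F$; others interior. For $g:E_F\to\mathbb{Z}$ and a path $P$, $g(P)$ is the sum of $g$ over arcs of $P$; $D(h)(v,v')=h(v')-h(v)$. Spin: $sp(v,v')=1$ if moving from $v$ to $v'$ there is a white cell on the left, $-1$ otherwise. For an elementary clockwise cycle $C$, $Dis_F(C)$ = (black cells of $F$ enclosed) $-$ (white cells of $F$ enclosed). An equilibrium function is a skew-symmetric $eq:E_F\to\mathbb{Z}$ with $sp(C)+eq(C)=4Dis_F(C)$ for every elementary clockwise cycle $C$. $\mathbf{t}(a)=eq(a)-sp(a)+2$, $\mathbf{b}(a)=eq(a)-sp(a)-2$ for interior arcs, $\mathbf{t}(a)=\mathbf{b}(a)=eq(a)+sp(a)$ for $a\in E_b(F)$. An elementary cycle $C$ of $G_F$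 is critical if $\mathbf{t}(C)=0$. Fix $w_0\in V_F$ on the boundary of $H_\infty$; $\mathcal{H}_F$ is the set of $h:V_F\to\mathbb{Z}$ with $h(w_0)=0$ and $D(h)(a)\in\{\mathbf{b}(a),\mathbf{t}(a)\}$ for all $a\in E_F$. -}

module Defs where

open import Data.Integer as ℤ using (ℤ; +_; -_; _+_; _-_; _*_; _≤_; _<_)
open import Data.Nat as ℕ using (ℕ)
open import Data.Bool using (Bool; true; false; if_then_else_; not; _∧_; _∨_)
open import Data.Product using (_×_; _,_; proj₁; proj₂; Σ; ∃; ∃-syntax; uncurry)
open import Data.Sum using (_⊎_)
open import Data.List using (List; []; _∷_; _++_; [_]; zip; map; foldr; length)
open import Data.List.Relation.Unary.All using (All)
open import Data.List.Relation.Unary.Unique.Propositional using (Unique)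
open import Data.List.Membership.Propositional using (_∈_; _∉_)
open import Data.Product.Properties using (≡-dec)
open import Relation.Binary.PropositionalEquality using (_≡_; _≢_)
open import Relation.Binary.Definitions using (DecidableEquality)
open import Relation.Nullary using (does)
import Data.List.Membership.DecPropositional as DecMem

-- Points of ℤ² and cells.  A cell is named by its lower-left corner:
-- cell (x , y) is the unit square [x, x+1] × [y, y+1].

Point : Set
Point = ℤ × ℤ

Cell : Set
Cell = ℤ × ℤ

_≟P_ : DecidableEquality Point
_≟P_ = ≡-dec ℤ._≟_ ℤ._≟_

open DecMem _≟P_ using (_∈?_)

sumℤ : List ℤ → ℤ
sumℤ = foldr _+_ (+ 0)

1ℤ : ℤ
1ℤ = + 1

isBlack : Cell → Bool
isBlack (x , y) = does (ℕ._≟_ (ℤ.∣ x + y ∣ ℕ.% 2) 0)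

isWhite : Cell → Bool
isWhite c = not (isBlack c)

colSign : Cell → ℤ
colSign c = if isBlack c then + 1 else - (+ 1)

Adj4 : Cell → Cell → Set
Adj4 (x , y) d =
  (d ≡ (x + 1ℤ , y)) ⊎ (d ≡ (x - 1ℤ , y)) ⊎ (d ≡ (x , y + 1ℤ)) ⊎ (d ≡ (x , y - 1ℤ))

Adj8 : Cell → Cell → Set
Adj8 (x , y) (x' , y') =
  ((x' ≡ x) ⊎ (x' ≡ x + 1ℤ) ⊎ (x' ≡ x - 1ℤ)) ×
  ((y' ≡ y) ⊎ (y' ≡ y + 1ℤ) ⊎ (y' ≡ y - 1ℤ)) ×
  ((x , y) ≢ (x' , y'))

data Chain (R : Cell → Cell → Set) (P : Cell → Set) : Cell → Cell → Set where
  stop : ∀ {c} → P c → Chain R P c c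
  step : ∀ {c d e} → P c → R c d → Chain R P d e → Chain R P c e

record Figure : Set where
  field
    cells     : List Cell
    unique    : Unique cells
    nonempty  : cells ≢ []
    connected : ∀ {c d} → c ∈ cells → d ∈ cells → Chain Adj4 (_∈ cells) c d
open Figure public

inF : Figure → Cell → Bool
inF F c = does (c ∈? cells F)

-- Vertices are points of ℤ² tagged by a Bool; the tag is
-- `true` only for the copy of a duplicated (pinch) vertex that belongs
-- to the cell lying to its left (smaller x-coordinate).

pinch : Figure → Point → Bool
pinch F (x , y) =
  (inF F (x , y) ∧ inF F (x - 1ℤ , y - 1ℤ) ∧ not (inF F (x - 1ℤ , y)) ∧ not (inF F (x , y - 1ℤ)))
  ∨ (inF F (x - 1ℤ , y) ∧ inF F (x , y - 1ℤ) ∧ not (inF F (x , y)) ∧ not (inF F (x - 1ℤ , y - 1ℤ)))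

V : Set
V = Point × Bool

pt : V → Point
pt = proj₁

vtx : Figure → Cell → Point → V
vtx F c p = p , (pinch F p ∧ does (proj₁ c ℤ.≟ proj₁ p - 1ℤ))

data Corner : Cell → Point → Set where
  ll : ∀ x y → Corner (x , y) (x , y)
  lr : ∀ x y → Corner (x , y) (x + 1ℤ , y)
  ur : ∀ x y → Corner (x , y) (x + 1ℤ , y + 1ℤ)
  ul : ∀ x y → Corner (x , y) (x , y + 1ℤ)

data Side : Cell → Point → Point → Set where
  bottom : ∀ x y → Side (x , y) (x , y) (x + 1ℤ , y)
  right  : ∀ x y → Side (x , y) (x + 1ℤ , y) (x + 1ℤ , y + 1ℤ)
  top    : ∀ x y → Side (x , y) (x + 1ℤ , y + 1ℤ) (x , y + 1ℤ)
  left   : ∀ x y → Side (x , y) (x , y + 1ℤ) (x , y)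
  rev    : ∀ {c p q} → Side c p q → Side c q p

IsVertex : Figure → V → Set
IsVertex F v = ∃[ c ] ∃[ p ] (c ∈ cells F × Corner c p × v ≡ vtx F c p)

Arc : Figure → V → V → Set
Arc F u v = ∃[ c ] ∃[ p ] ∃[ q ]
  (c ∈ cells F × Side c p q × u ≡ vtx F c p × v ≡ vtx F c q)

leftCell : Point → Point → Cell
leftCell (x , y) (x' , y') =
  if does (x' ℤ.≟ x + 1ℤ) then (x , y)
  else if does (x' ℤ.≟ x - 1ℤ) then (x - 1ℤ , y - 1ℤ)
  else if does (y' ℤ.≟ y + 1ℤ) then (x - 1ℤ , y)
  else (x , y - 1ℤ)

rightCell : Point → Point → Cell
rightCell p q = leftCell q p

sp : V → V → ℤ
sp u v = if isWhite (leftCell (pt u) (pt v)) then + 1 else - (+ 1)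

isBdry : Figure → V → V → Bool
isBdry F u v = not (inF F (leftCell (pt u) (pt v)) ∧ inF F (rightCell (pt u) (pt v)))

Fun : Set
Fun = V → V → ℤ

tt : Figure → Fun → Fun
tt F eq u v = if isBdry F u v then eq u v + sp u v else eq u v - sp u v + + 2

bb : Figure → Fun → Fun
bb F eq u v = if isBdry F u v then eq u v + sp u v else eq u v - sp u v - + 2

-- Cycles: a cycle is given by its list of vertices v₀ … v_{k-1};
-- its arcs are (v₀,v₁), …, (v_{k-1},v₀).

closedPairs : List V → List (V × V)
closedPairs [] = []
closedPairs (v ∷ vs) = zip (v ∷ vs) (vs ++ [ v ])

csum : Fun → List V → ℤ
csum g vs = sumℤ (map (uncurry g) (closedPairs vs))

ElemCycle : Figure → List V → Set
ElemCycle F vs = (3 ℕ.≤ length vs) × Unique vs × All (uncurry (Arc F)) (closedPairs vs)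

-- contribution of the step p → q to the winding number around the
-- centre of cell (i , j) (ray to the right of the centre)
crossing : Cell → Point → Point → ℤ
crossing (i , j) (px , py) (qx , qy) =
  if does (qx ℤ.≟ px) ∧ does (i ℤ.<? px) ∧ does (py ℤ.≟ j) ∧ does (qy ℤ.≟ j + 1ℤ) then + 1
  else if does (qx ℤ.≟ px) ∧ does (i ℤ.<? px) ∧ does (py ℤ.≟ j + 1ℤ) ∧ does (qy ℤ.≟ j) then - (+ 1)
  else + 0

winding : List V → Cell → ℤ
winding vs c = sumℤ (map (λ a → crossing c (pt (proj₁ a)) (pt (proj₂ a))) (closedPairs vs))

Clockwise : List V → Set
Clockwise vs = ∀ c → (winding vs c ≡ + 0) ⊎ (winding vs c ≡ - (+ 1))

enclosed : List V → Cell → Bool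
enclosed vs c = not (does (winding vs c ℤ.≟ + 0))

Dis : Figure → List V → ℤ
Dis F vs = sumℤ (map (λ c → if enclosed vs c then colSign c else + 0) (cells F))

Equilibrium : Figure → Fun → Set
Equilibrium F eq =
  (∀ u v → Arc F u v → eq v u ≡ - eq u v) ×
  (∀ vs → ElemCycle F vs → Clockwise vs → csum sp vs + csum eq vs ≡ + 4 * Dis F vs)

Critical : Figure → Fun → List V → Set
Critical F eq vs = ElemCycle F vs × csum (tt F eq) vs ≡ + 0

InHinf : Figure → Cell → Set
InHinf F c = ∃[ d ] (All (λ e → proj₁ e < proj₁ d) (cells F) × Chain Adj8 (_∉ cells F) c d)

OnBdryHinf : Figure → V → Set
OnBdryHinf F w = IsVertex F w × ∃[ c ] (Corner c (pt w) × InHinf F c)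

IsHeight : Figure → Fun → V → (V → ℤ) → Set
IsHeight F eq w₀ h = (h w₀ ≡ + 0) ×
  (∀ u v → Arc F u v → (h v - h u ≡ bb F eq u v) ⊎ (h v - h u ≡ tt F eq u v))

-- Every height function h satisfies D(h)(a) ≤ t(a) on each arc, while D(h) sums to
-- zero around any cycle.  On a critical cycle t also sums to zero, so all these
-- inequalities are equalities: every height function increases by exactly t along
-- each arc of the cycle.  Hence h - h' does not change along the cycle.
module Submission where

open import Defs
open import Data.Integer using (ℤ; _-_)
open import Data.List using (List)
open import Data.List.Membership.Propositional using (_∈_)
open import Relation.Binary.PropositionalEquality using (_≡_)

open import Algebra.Properties.AbelianGroup as AbelianGroupProperties using ()
open import Data.Bool using (true; false)
open import Data.Empty using (⊥-elim)
open import Data.Integer using (+_; _+_; _≤_; _≟_; -≤+)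
open import Data.Integer.Properties
  using (≤-refl; +-monoʳ-≤; +-mono-≤; +-mono-<-≤; ≤∧≢⇒<; <⇒≢; +-identityʳ; i≡j⇒i-j≡0; +-0-abelianGroup)
open import Data.Integer.Tactic.RingSolver using (solve-∀)
open import Data.List using ([]; _∷_; _++_; [_]; zip; map)
open import Data.List.Relation.Unary.All as All using (All; []; _∷_)
open import Data.List.Relation.Unary.Any using (here; there)
open import Data.Product using (_,_; proj₁; proj₂; uncurry)
open import Data.Sum using (inj₁; inj₂)
open import Relation.Nullary using (yes; no)
open import Relation.Binary.PropositionalEquality using (refl; sym; trans; cong; subst; module ≡-Reasoning)

open AbelianGroupProperties +-0-abelianGroup using () renaming (∙-cancelˡ to +-cancelˡ-≡)

module _ {A : Set} {f g : A → ℤ} where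

  sum-mono-≤ : ∀ {xs} → All (λ x → f x ≤ g x) xs → sumℤ (map f xs) ≤ sumℤ (map g xs)
  sum-mono-≤ []                = ≤-refl
  sum-mono-≤ (fx≤gx ∷ fxs≤gxs) = +-mono-≤ fx≤gx (sum-mono-≤ fxs≤gxs)

  sum-≡⇒pointwise-≡ : ∀ {xs} → All (λ x → f x ≤ g x) xs →
    sumℤ (map f xs) ≡ sumℤ (map g xs) → All (λ x → f x ≡ g x) xs
  sum-≡⇒pointwise-≡ []                          _     = []
  sum-≡⇒pointwise-≡ {x ∷ xs} (fx≤gx ∷ fxs≤gxs) Σf≡Σg with f x ≟ g x
  ... | yes fx≡gx = fx≡gx ∷ sum-≡⇒pointwise-≡ fxs≤gxs
    (+-cancelˡ-≡ (g x) _ _ (trans (cong (_+ sumℤ (map f xs)) (sym fx≡gx)) Σf≡Σg))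
  ... | no fx≢gx  = ⊥-elim (<⇒≢ (+-mono-<-≤ (≤∧≢⇒< fx≤gx fx≢gx) (sum-mono-≤ fxs≤gxs)) Σf≡Σg)

Δ : (V → ℤ) → Fun
Δ h u v = h v - h u

path-telescopes : ∀ h x y xs →
  sumℤ (map (uncurry (Δ h)) (zip (x ∷ xs) (xs ++ [ y ]))) ≡ h y - h x
path-telescopes h x y []        = +-identityʳ (h y - h x)
path-telescopes h x y (x' ∷ xs) = begin
  (h x' - h x) + sumℤ (map (uncurry (Δ h)) (zip (x' ∷ xs) (xs ++ [ y ])))
    ≡⟨ cong (λ s → (h x' - h x) + s) (path-telescopes h x' y xs) ⟩
  (h x' - h x) + (h y - h x')
    ≡⟨ chasles (h x) (h x') (h y) ⟩
  h y - h x ∎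
  where
  open ≡-Reasoning
  chasles : ∀ a b c → (b - a) + (c - b) ≡ c - a
  chasles = solve-∀

csum-Δ≡0 : ∀ h C → csum (Δ h) C ≡ + 0
csum-Δ≡0 h []      = refl
csum-Δ≡0 h (x ∷ xs) = trans (path-telescopes h x x xs) (i≡j⇒i-j≡0 {h x} refl)

path-constant : ∀ (f : V → ℤ) x y xs →
  All (λ p → f (proj₁ p) ≡ f (proj₂ p)) (zip (x ∷ xs) (xs ++ [ y ])) →
  ∀ {z} → z ∈ x ∷ xs → f z ≡ f x
path-constant f x y xs        _             (here refl) = refl
path-constant f x y (x' ∷ xs) (fx≡fx' ∷ fs) (there z∈)  =
  trans (path-constant f x' y xs fs z∈) (sym fx≡fx')

closedPairs-constant : ∀ (f : V → ℤ) C →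
  All (λ p → f (proj₁ p) ≡ f (proj₂ p)) (closedPairs C) →
  ∀ {z z'} → z ∈ C → z' ∈ C → f z ≡ f z'
closedPairs-constant f (x ∷ xs) fs z∈ z'∈ =
  trans (path-constant f x x xs fs z∈) (sym (path-constant f x x xs fs z'∈))

bb≤tt : ∀ F eq u v → bb F eq u v ≤ tt F eq u v
bb≤tt F eq u v with isBdry F u v
... | true  = ≤-refl
... | false = +-monoʳ-≤ (eq u v - sp u v) -≤+

module _ (F : Figure) (eq : Fun) {w₀ : V} (h : V → ℤ) (h-height : IsHeight F eq w₀ h) where

  Δ≤tt : ∀ {u v} → Arc F u v → Δ h u v ≤ tt F eq u v
  Δ≤tt {u} {v} a with proj₂ h-height u v a
  ... | inj₁ Δh≡bb = subst (_≤ tt F eq u v) (sym Δh≡bb) (bb≤tt F eq u v)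
  ... | inj₂ Δh≡tt = subst (_≤ tt F eq u v) (sym Δh≡tt) ≤-refl

  Δ≡tt-on-critical : ∀ {C} → Critical F eq C →
    All (λ p → Δ h (proj₁ p) (proj₂ p) ≡ tt F eq (proj₁ p) (proj₂ p)) (closedPairs C)
  Δ≡tt-on-critical {C} ((_ , _ , arcs) , t[C]≡0) =
    sum-≡⇒pointwise-≡ (All.map Δ≤tt arcs) (trans (csum-Δ≡0 h C) (sym t[C]≡0))

equal-increments⇒equal-differences : ∀ a a' b b' → a' - a ≡ b' - b → a - b ≡ a' - b'
equal-increments⇒equal-differences a a' b b' e = begin
  a - b                               ≡⟨ regroup a a' b b' ⟩
  (a' - b') - ((a' - a) - (b' - b))   ≡⟨ cong ((a' - b') -_) (i≡j⇒i-j≡0 e) ⟩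
  (a' - b') - + 0                     ≡⟨ +-identityʳ (a' - b') ⟩
  a' - b' ∎
  where
  open ≡-Reasoning
  regroup : ∀ a a' b b' → a - b ≡ (a' - b') - ((a' - a) - (b' - b))
  regroup = solve-∀

mainTheorem6 : (F : Figure) (eq : Fun) → Equilibrium F eq →
    (w₀ : V) → OnBdryHinf F w₀ →
    (C : List V) → Critical F eq C →
    (v v' : V) → v ∈ C → v' ∈ C →
    (h h' : V → ℤ) → IsHeight F eq w₀ h → IsHeight F eq w₀ h' →
    h v - h' v ≡ h v' - h' v'
mainTheorem6 F eq _ w₀ _ C C-critical v v' v∈C v'∈C h h' h-height h'-height =
  closedPairs-constant (λ z → h z - h' z) C difference-preserved v∈C v'∈C
  where
  difference-preserved : All (λ p → h (proj₁ p) - h' (proj₁ p) ≡ h (proj₂ p) - h' (proj₂ p)) (closedPairs C)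
  difference-preserved = All.zipWith
    (λ {p} (Δh≡t , Δh'≡t) → equal-increments⇒equal-differences
      (h (proj₁ p)) (h (proj₂ p)) (h' (proj₁ p)) (h' (proj₂ p)) (trans Δh≡t (sym Δh'≡t)))
    (Δ≡tt-on-critical F eq h h-height C-critical , Δ≡tt-on-critical F eq h' h'-height C-critical)
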